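{- For every Lebesgue null set $N\subseteq 2^\omega$ there is a family $\langle E_J : J\in\mathsf{IP}\rangle$ of members of $\mathcal{E}$ such that $J\sqsubset J'$ implies $E_J\subseteq E_{J'}$, and $N\subseteq\bigcup_{J\in\mathsf{IP}}E_J$.
   Context: $\mathcal{E}$ is the $\sigma$-ideal on $2^\omega$ generated by closed Lebesgue null sets. $\mathsf{IP}$ is the set of interval partitions of $\omega$ (partitions $\langle J_k : k\in\omega\rangle$ of $\omega$ into consecutive finite intervals). For $I=\langle I_n\rangle, J=\langle J_k\rangle \in\mathsf{IP}$, $I\sqsubset J$ means: for all but finitely many $k$ there is $n$ with $I_n\subseteq J_k$. -}

module Defs where

open import Data.Nat using (ℕ; zero; suc; _≤_; _<_)
open import Data.Bool using (Bool)
open import Data.List using (List; []; _∷_; length)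
open import Data.Maybe using (Maybe; just)
open import Data.Product using (Σ; ∃; _×_; _,_)
open import Data.Unit using (⊤)
open import Relation.Nullary using (¬_)
open import Relation.Binary.PropositionalEquality using (_≡_)
open import Data.Rational using (ℚ; 0ℚ; 1ℚ; ½; _+_; _*_) renaming (_≤_ to _≤ℚ_)

Cantor : Set
Cantor = ℕ → Bool

SubsetC : Set₁
SubsetC = Cantor → Set

_⊆C_ : SubsetC → SubsetC → Set
A ⊆C B = ∀ x → A x → B x

_≺_ : List Bool → Cantor → Set
[]      ≺ x = ⊤
(b ∷ s) ≺ x = (x 0 ≡ b) × (s ≺ (λ i → x (suc i)))

-- (1/2)^n, the Lebesgue measure of a basic clopen set [s] with |s| = n
half^ : ℕ → ℚ
half^ zero    = 1ℚ
half^ (suc n) = ½ * half^ n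

partialMeasure : (ℕ → List Bool) → ℕ → ℚ
partialMeasure σ zero    = 0ℚ
partialMeasure σ (suc n) = partialMeasure σ n + half^ (length (σ n))

IsNull : SubsetC → Set
IsNull N = ∀ (k : ℕ) → Σ (ℕ → List Bool) λ σ →
  (∀ n → partialMeasure σ n ≤ℚ half^ k) × (∀ x → N x → ∃ λ i → σ i ≺ x)

-- closed: complement of an open set, i.e. of a countable union of basic clopen
-- sets (Maybe allows the empty open set)
IsClosed : SubsetC → Set
IsClosed C = Σ (ℕ → Maybe (List Bool)) λ τ →
  ∀ x → (C x → ¬ (∃ λ i → Σ (List Bool) λ s → (τ i ≡ just s) × (s ≺ x)))
      × (¬ (∃ λ i → Σ (List Bool) λ s → (τ i ≡ just s) × (s ≺ x)) → C x)

-- membership in the σ-ideal ℰ generated by closed null sets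
InE : SubsetC → Set₁
InE E = Σ (ℕ → SubsetC) λ C →
  (∀ m → IsClosed (C m) × IsNull (C m)) × (∀ x → E x → ∃ λ m → C m x)

-- interval partitions: J_k = [p k, p (suc k)), p 0 = 0, p strictly increasing
record IP : Set where
  field
    pt    : ℕ → ℕ
    pt0   : pt 0 ≡ 0
    ptInc : ∀ k → pt k < pt (suc k)
open IP public

_⊏_ : IP → IP → Set
I ⊏ J = ∃ λ K → ∀ k → K ≤ k → ∃ λ n →
  (pt J k ≤ pt I n) × (pt I (suc n) ≤ pt J (suc k))

-- Fix covers σ_k of N by basic clopen sets [σ_k i] of total measure ≤ 2⁻ᵏ. For b : ℕ → ℕ the set
-- C_b = ⋂_k ⋃_{i<b(k)} [σ_k i] is an intersection of clopen sets, hence closed, and it lies inside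
-- ⋃_i [σ_k i] for every k, hence null. Put E_J = ⋃_K C_{j ↦ min J_{K+j}}. Every x ∈ N is in
-- some E_J: choose J so that J_{j+1} starts beyond the index of a member of σ_j containing x.
-- If I ⊏ J then the intervals of J eventually contain pairwise distinct intervals of I, so
-- min I_m ≤ min J_{K+m} for some K, which shifts each C_b of E_I into one of E_J.
module Submission where

open import Defs
open import Data.Rational using () renaming (_≤_ to _≤ℚ_)
open import Data.Bool using (Bool; true; false; _≟_)
open import Data.List using (List; []; _∷_; length; applyUpTo)
open import Data.List.Properties using (length-applyUpTo)
open import Data.List.Relation.Binary.Prefix.Heterogeneous using (Prefix; []; _∷_)
open import Data.List.Relation.Binary.Prefix.Heterogeneous.Properties using (prefix?)
open import Data.Maybe using (Maybe; just; nothing)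
open import Data.Nat using (ℕ; zero; suc; _+_; _⊔_; _≤_; _<_; z≤n; s≤s; _≤?_)
open import Data.Nat.Binary using (ℕᵇ; zero; 2[1+_]; 1+[2_]; toℕ; fromℕ)
open import Data.Nat.Binary.Properties using (toℕ-fromℕ; fromℕ-toℕ)
open import Data.Nat.Properties using (≤-refl; ≤-reflexive; ≤-trans; <-trans; <⇒≤; <-≤-trans; ≮⇒≥; <⇒≱; m≤n⇒m<n∨m≡n; m≤m⊔n; m≤n⊔m; m≤m+n; m≤n+m; +-suc; +-assoc; anyUpTo?; allUpTo?)
open import Data.Product using (Σ; ∃; _×_; _,_; proj₁; proj₂; map₁; map₂; uncurry)
open import Data.Unit using (tt)
open import Data.Sum using (inj₁; inj₂)
open import Function using (_∘_)
open import Relation.Nullary using (¬_; Dec; yes; no; ¬?; contradiction)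
open import Relation.Nullary.Decidable using (_×-dec_)
open import Relation.Unary using (Decidable)
open import Relation.Binary.PropositionalEquality using (_≡_; refl; sym; trans; cong; subst; module ≡-Reasoning)

-- ℕᵇ is bijective base 2, so its terms are exactly the finite bit strings.
toBits : ℕᵇ → List Bool
toBits zero     = []
toBits 2[1+ x ] = true ∷ toBits x
toBits 1+[2 x ] = false ∷ toBits x

fromBits : List Bool → ℕᵇ
fromBits []          = zero
fromBits (true ∷ t)  = 2[1+ fromBits t ]
fromBits (false ∷ t) = 1+[2 fromBits t ]

toBits-fromBits : ∀ t → toBits (fromBits t) ≡ t
toBits-fromBits []          = refl
toBits-fromBits (true ∷ t)  = cong (true ∷_) (toBits-fromBits t)
toBits-fromBits (false ∷ t) = cong (false ∷_) (toBits-fromBits t)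

enumList : ℕ → List Bool
enumList = toBits ∘ fromℕ

enumList-surjective : ∀ t → ∃ λ n → enumList n ≡ t
enumList-surjective t =
  toℕ (fromBits t) , trans (cong toBits (fromℕ-toℕ (fromBits t))) (toBits-fromBits t)

pairᵇ : ℕ → ℕᵇ → ℕᵇ
pairᵇ zero    y = 1+[2 y ]
pairᵇ (suc j) y = 2[1+ pairᵇ j y ]

unpairᵇ : ℕᵇ → ℕ × ℕᵇ
unpairᵇ zero     = 0 , zero
unpairᵇ 1+[2 x ] = 0 , x
unpairᵇ 2[1+ x ] = map₁ suc (unpairᵇ x)

unpairᵇ-pairᵇ : ∀ j y → unpairᵇ (pairᵇ j y) ≡ (j , y)
unpairᵇ-pairᵇ zero    y = refl
unpairᵇ-pairᵇ (suc j) y = cong (map₁ suc) (unpairᵇ-pairᵇ j y)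

unpair : ℕ → ℕ × ℕ
unpair = map₂ toℕ ∘ unpairᵇ ∘ fromℕ

unpair-surjective : ∀ j m → ∃ λ n → unpair n ≡ (j , m)
unpair-surjective j m = toℕ (pairᵇ j (fromℕ m)) , (begin
  map₂ toℕ (unpairᵇ (fromℕ (toℕ (pairᵇ j (fromℕ m)))))
    ≡⟨ cong (map₂ toℕ ∘ unpairᵇ) (fromℕ-toℕ (pairᵇ j (fromℕ m))) ⟩
  map₂ toℕ (unpairᵇ (pairᵇ j (fromℕ m)))
    ≡⟨ cong (map₂ toℕ) (unpairᵇ-pairᵇ j (fromℕ m)) ⟩
  (j , toℕ (fromℕ m))
    ≡⟨ cong (j ,_) (toℕ-fromℕ m) ⟩
  (j , m) ∎)
  where open ≡-Reasoning

_≺?_ : ∀ s x → Dec (s ≺ x)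
[]      ≺? x = yes tt
(b ∷ s) ≺? x = (x 0 ≟ b) ×-dec (s ≺? (x ∘ suc))

≺-prefix : ∀ {s t x} → s ≺ x → t ≺ x → length s ≤ length t → Prefix _≡_ s t
≺-prefix {[]}                    _          _          _         = []
≺-prefix {_ ∷ _} {_ ∷ _} (a≡ , s≺x) (b≡ , t≺x) (s≤s s≤t) =
  trans (sym a≡) b≡ ∷ ≺-prefix s≺x t≺x s≤t

prefix-≺ : ∀ {s t x} → Prefix _≡_ s t → t ≺ x → s ≺ x
prefix-≺ []         _          = tt
prefix-≺ (refl ∷ p) (b≡ , t≺x) = b≡ , prefix-≺ p t≺x

applyUpTo-≺ : ∀ x L → applyUpTo x L ≺ x
applyUpTo-≺ x zero    = tt
applyUpTo-≺ x (suc L) = refl , applyUpTo-≺ (x ∘ suc) L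

_∈Open_ : Cantor → (ℕ → Maybe (List Bool)) → Set
x ∈Open τ = ∃ λ i → Σ (List Bool) λ s → (τ i ≡ just s) × (s ≺ x)

module _ {K : List Bool → Set} (K? : Decidable K) where

  select : List Bool → Maybe (List Bool)
  select t with K? t
  ... | yes _ = just t
  ... | no  _ = nothing

  select-sound : ∀ {t u} → select t ≡ just u → K u
  select-sound {t} e with K? t
  select-sound refl | yes k = k

  select-complete : ∀ {t} → K t → select t ≡ just t
  select-complete {t} k with K? t
  ... | yes _  = refl
  ... | no ¬k = contradiction k ¬k

  openCode : ℕ → Maybe (List Bool)
  openCode = select ∘ enumList

  openCode-sound : ∀ {x} → x ∈Open openCode → ∃ λ t → K t × t ≺ x
  openCode-sound (_ , t , e , t≺x) = t , select-sound e , t≺x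

  openCode-complete : ∀ {t x} → K t → t ≺ x → x ∈Open openCode
  openCode-complete {t} k t≺x with enumList-surjective t
  ... | n , refl = n , t , select-complete k , t≺x

⋂-closed : (C : ℕ → SubsetC) → (∀ j → IsClosed (C j)) → IsClosed (λ x → ∀ j → C j x)
⋂-closed C closed = τ , λ x → disjoint x , covers x
  where
  code : ℕ → ℕ → Maybe (List Bool)
  code j = proj₁ (closed j)

  τ : ℕ → Maybe (List Bool)
  τ = uncurry code ∘ unpair

  disjoint : ∀ x → (∀ j → C j x) → ¬ x ∈Open τ
  disjoint x x∈C (n , s , e , s≺x) =
    proj₁ (proj₂ (closed (proj₁ (unpair n))) x) (x∈C _) (proj₂ (unpair n) , s , e , s≺x)

  covers : ∀ x → ¬ x ∈Open τ → ∀ j → C j x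
  covers x x∉τ j = proj₂ (proj₂ (closed j) x) λ (m , s , e , s≺x) →
    let n , n↦jm = unpair-surjective j m in
    x∉τ (n , s , trans (cong (uncurry code) n↦jm) e , s≺x)

maxLength : (ℕ → List Bool) → ℕ → ℕ
maxLength s zero    = 0
maxLength s (suc b) = length (s b) ⊔ maxLength s b

length≤maxLength : ∀ s {i b} → i < b → length (s i) ≤ maxLength s b
length≤maxLength s {i} {suc b} (s≤s i≤b) with m≤n⇒m<n∨m≡n i≤b
... | inj₁ i<b  = ≤-trans (length≤maxLength s i<b) (m≤n⊔m (length (s b)) (maxLength s b))
... | inj₂ refl = m≤m⊔n (length (s i)) (maxLength s i)

CylinderUnion : (ℕ → List Bool) → ℕ → SubsetC
CylinderUnion s b x = ∃ λ i → i < b × s i ≺ x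

-- Once t is at least as long as every s i, [t] meets [s i] only if s i is a prefix of t.
cylinderUnion-closed : ∀ s b → IsClosed (CylinderUnion s b)
cylinderUnion-closed s b = openCode Avoids? , λ x → disjoint x , covers x
  where
  L : ℕ
  L = maxLength s b

  Avoids : List Bool → Set
  Avoids t = L ≤ length t × (∀ {i} → i < b → ¬ Prefix _≡_ (s i) t)

  Avoids? : Decidable Avoids
  Avoids? t = (L ≤? length t) ×-dec allUpTo? (λ i → ¬? (prefix? _≟_ (s i) t)) b

  disjoint : ∀ x → CylinderUnion s b x → ¬ x ∈Open openCode Avoids?
  disjoint x (i , i<b , sᵢ≺x) x∈τ with openCode-sound Avoids? x∈τ
  ... | t , (L≤t , avoids) , t≺x =
    avoids i<b (≺-prefix sᵢ≺x t≺x (≤-trans (length≤maxLength s i<b) L≤t))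

  covers : ∀ x → ¬ x ∈Open openCode Avoids? → CylinderUnion s b x
  covers x x∉τ with anyUpTo? (λ i → s i ≺? x) b
  ... | yes x∈ = x∈
  ... | no  x∉ = contradiction (openCode-complete Avoids? (L≤L , avoids) (applyUpTo-≺ x L)) x∉τ
    where
    L≤L : L ≤ length (applyUpTo x L)
    L≤L = ≤-reflexive (sym (length-applyUpTo x L))

    avoids : ∀ {i} → i < b → ¬ Prefix _≡_ (s i) (applyUpTo x L)
    avoids i<b sᵢ⊑ = x∉ (_ , i<b , prefix-≺ sᵢ⊑ (applyUpTo-≺ x L))

TruncatedCover : (ℕ → ℕ → List Bool) → (ℕ → ℕ) → SubsetC
TruncatedCover σ b x = ∀ j → CylinderUnion (σ j) (b j) x

truncatedCover-closed : ∀ σ b → IsClosed (TruncatedCover σ b)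
truncatedCover-closed σ b = ⋂-closed _ λ j → cylinderUnion-closed (σ j) (b j)

truncatedCover-null : ∀ {σ} → (∀ k n → partialMeasure (σ k) n ≤ℚ half^ k) →
  ∀ b → IsNull (TruncatedCover σ b)
truncatedCover-null {σ} small _ k = σ k , small k , λ x x∈ →
  let i , _ , σₖᵢ≺x = x∈ k in i , σₖᵢ≺x

truncatedCover-mono : ∀ σ {b b′} → (∀ j → b j ≤ b′ j) → TruncatedCover σ b ⊆C TruncatedCover σ b′
truncatedCover-mono σ b≤b′ x x∈ j =
  let i , i<b , σⱼᵢ≺x = x∈ j in i , <-≤-trans i<b (b≤b′ j) , σⱼᵢ≺x

pt-<-mono : ∀ J {m n} → m < n → pt J m < pt J n
pt-<-mono J {m} {suc n} (s≤s m≤n) with m≤n⇒m<n∨m≡n m≤n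
... | inj₁ m<n  = <-trans (pt-<-mono J m<n) (ptInc J n)
... | inj₂ refl = ptInc J n

pt-≤-mono : ∀ J {m n} → m ≤ n → pt J m ≤ pt J n
pt-≤-mono J m≤n with m≤n⇒m<n∨m≡n m≤n
... | inj₁ m<n  = <⇒≤ (pt-<-mono J m<n)
... | inj₂ refl = ≤-refl

pt-cancel-≤ : ∀ J {m n} → pt J m ≤ pt J n → m ≤ n
pt-cancel-≤ J ptₘ≤ptₙ = ≮⇒≥ λ n<m → <⇒≱ (pt-<-mono J n<m) ptₘ≤ptₙ

⊏⇒pt-≤ : ∀ I J → I ⊏ J → ∃ λ K → ∀ m → pt I m ≤ pt J (K + m)
⊏⇒pt-≤ I J (K , contains) = K , λ m →
  let n , m≤n , Iₙ≤ = reach m in ≤-trans (pt-≤-mono I m≤n) Iₙ≤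
  where
  -- J_K, …, J_{K+m-1} contain I-intervals of strictly increasing index.
  reach : ∀ m → ∃ λ n → m ≤ n × pt I n ≤ pt J (K + m)
  reach zero = 0 , z≤n , subst (_≤ pt J (K + 0)) (sym (pt0 I)) z≤n
  reach (suc m) with reach m | contains (K + m) (m≤m+n K m)
  ... | n , m≤n , Iₙ≤Jₖ₊ₘ | n′ , Jₖ₊ₘ≤Iₙ′ , Iₙ′₊₁≤ =
    suc n′ , s≤s (≤-trans m≤n (pt-cancel-≤ I (≤-trans Iₙ≤Jₖ₊ₘ Jₖ₊ₘ≤Iₙ′))) ,
    subst (λ k → pt I (suc n′) ≤ pt J k) (sym (+-suc K m)) Iₙ′₊₁≤

IP-dominating : (f : ℕ → ℕ) → Σ IP λ J → ∀ j → f j < pt J (suc j)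
IP-dominating f = J , λ j → s≤s (m≤m+n (f j) (p j))
  where
  p : ℕ → ℕ
  p zero    = 0
  p (suc j) = suc (f j + p j)

  J : IP
  J = record { pt = p ; pt0 = refl ; ptInc = λ j → s≤s (m≤n+m (p j) (f j)) }

E : (ℕ → ℕ → List Bool) → IP → SubsetC
E σ J x = ∃ λ K → TruncatedCover σ (λ j → pt J (K + j)) x

E-∈ℰ : ∀ {σ} → (∀ k n → partialMeasure (σ k) n ≤ℚ half^ k) → ∀ J → InE (E σ J)
E-∈ℰ {σ} small J =
  (λ K → TruncatedCover σ (λ j → pt J (K + j))) ,
  (λ K → truncatedCover-closed σ _ , truncatedCover-null small _) ,
  λ x x∈E → x∈E

E-mono : ∀ σ I J → I ⊏ J → E σ I ⊆C E σ J
E-mono σ I J I⊏J x (K , x∈) =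
  K₀ + K , truncatedCover-mono σ {λ j → pt I (K + j)} Iₖ₊ⱼ≤ x x∈
  where
  K₀ : ℕ
  K₀ = proj₁ (⊏⇒pt-≤ I J I⊏J)

  Iₖ₊ⱼ≤ : ∀ j → pt I (K + j) ≤ pt J (K₀ + K + j)
  Iₖ₊ⱼ≤ j = subst (λ k → pt I (K + j) ≤ pt J k) (sym (+-assoc K₀ K j))
                   (proj₂ (⊏⇒pt-≤ I J I⊏J) (K + j))

E-covers : ∀ σ {x} → (∀ j → ∃ λ i → σ j i ≺ x) → ∃ λ J → E σ J x
E-covers σ hits =
  let J , dominates = IP-dominating (proj₁ ∘ hits) in
  J , 1 , λ j → proj₁ (hits j) , dominates j , proj₂ (hits j)

lemma7p1 : (N : SubsetC) → IsNull N →
    Σ (IP → SubsetC) λ E →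
      (∀ J → InE (E J))
      × (∀ J J′ → J ⊏ J′ → E J ⊆C E J′)
      × (∀ x → N x → ∃ λ J → E J x)
lemma7p1 N null =
  E σ , E-∈ℰ (proj₁ ∘ proj₂ ∘ null) , E-mono σ , λ x x∈N → E-covers σ (σ-hits x x∈N)
  where
  σ : ℕ → ℕ → List Bool
  σ = proj₁ ∘ null

  σ-hits : ∀ x → N x → ∀ j → ∃ λ i → σ j i ≺ x
  σ-hits x x∈N j = proj₂ (proj₂ (null j)) x x∈N
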